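{- Let $\mathcal{G}$ be a hypergraph on vertex set $V$, let $(T,S)$ be a $k$-trace on $V$, and let $V':=V\setminus(S\setminus T)$. Then there exists a minimal transversal of $\mathcal{G}$ realizing $(T,S)$ if and only if $T$ is a sub-transversal of the hypergraph $\mathcal{G}'=(V',\{F\cap V'\mid F\in\mathcal{G}\})$.
   Context: A hypergraph on $V$ is a family of subsets of the finite set $V$. A transversal of a hypergraph is a vertex set meeting every hyperedge; it is minimal if it contains no other transversal. A $k$-trace on $V$ is a pair $(T,S)$ with $T\subseteq S\subseteq V$, $|S|=k$; a set $E$ realizes $(T,S)$ if $E\cap S=T$. A set $T$ of vertices is a sub-transversal of a hypergraph $\mathcal{H}$ if some minimal transversal of $\mathcal{H}$ contains $T$. -}

module Defs where

open import Data.Nat using (ℕ)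
open import Data.List using (List; map)
open import Data.List.Membership.Propositional using () renaming (_∈_ to _∈ₗ_)
open import Data.Fin.Subset using (Subset; _⊆_; _∩_; _─_; ∣_∣; Nonempty; ⊤)
open import Data.Product using (Σ; _×_)
open import Relation.Binary.PropositionalEquality using (_≡_)

Hypergraph : ℕ → Set
Hypergraph n = List (Subset n)

TransversalOn : ∀ {n} → Subset n → Hypergraph n → Subset n → Set
TransversalOn W H X = X ⊆ W × (∀ {E} → E ∈ₗ H → Nonempty (X ∩ E))

MinimalTransversalOn : ∀ {n} → Subset n → Hypergraph n → Subset n → Set
MinimalTransversalOn W H X =
  TransversalOn W H X × (∀ Y → Y ⊆ X → TransversalOn W H Y → Y ≡ X)

SubTransversalOn : ∀ {n} → Subset n → Hypergraph n → Subset n → Set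
SubTransversalOn W H T = Σ (Subset _) λ X → MinimalTransversalOn W H X × T ⊆ X

MinimalTransversal : ∀ {n} → Hypergraph n → Subset n → Set
MinimalTransversal = MinimalTransversalOn ⊤

IsTrace : ∀ {n} → ℕ → Subset n → Subset n → Set
IsTrace k T S = T ⊆ S × ∣ S ∣ ≡ k

Realizes : ∀ {n} → Subset n → Subset n → Subset n → Set
Realizes E T S = E ∩ S ≡ T

restrict : ∀ {n} → Subset n → Hypergraph n → Hypergraph n
restrict W H = map (λ F → F ∩ W) H

{-# OPTIONS --safe #-}
-- A set E realizes (T , S) exactly when T ⊆ E ⊆ V', since V' removes precisely the
-- vertices of S that E must avoid.  For a set X ⊆ V', meeting a hyperedge F is the
-- same as meeting F ∩ V', so the transversals of G lying inside V' are exactly the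
-- transversals of G' on V'.  All subsets of such a transversal again lie inside V',
-- so minimality transfers as well.
module Submission where

open import Defs
open import Data.Nat using (ℕ)
open import Data.Fin using (Fin)
open import Data.Fin.Subset using (Subset; _─_; ⊤; _∈_; _∉_; _⊆_; _∩_; Nonempty; inside; outside)
open import Data.Fin.Subset.Properties
  using (_∈?_; ∈⊤; ⊆⊤; ⊆-trans; ⊆-antisym; ∩-assoc; ∩-comm; p∩q⊆p; x∈p∩q⁺; x∈p∩q⁻; x∈p∧x∉q⇒x∈p─q; p─q⊆p)
open import Data.List.Membership.Propositional using () renaming (_∈_ to _∈ₗ_)
open import Data.List.Membership.Propositional.Properties using (∈-map⁺; ∈-map⁻)
open import Data.Product using (Σ; _×_; _,_; proj₁)
open import Data.Vec using (_∷_; here; there)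
open import Function.Bundles using (_⇔_; mk⇔; module Equivalence)
open import Relation.Nullary using (yes; no; contradiction)
open import Relation.Binary.PropositionalEquality using (_≡_; refl; sym; cong; subst; module ≡-Reasoning)

open Equivalence using (to; from)

private
  variable
    n : ℕ
    x : Fin n

x∈p─q⇒x∉q : ∀ (p q : Subset n) → x ∈ p ─ q → x ∉ q
x∈p─q⇒x∉q (inside ∷ p) (outside ∷ q) here        ()
x∈p─q⇒x∉q (_      ∷ p) (_       ∷ q) (there x∈) (there x∈q) = x∈p─q⇒x∉q p q x∈ x∈q

p⊆q⇒p∩q≡p : {p q : Subset n} → p ⊆ q → p ∩ q ≡ p
p⊆q⇒p∩q≡p {p = p} {q} p⊆q = ⊆-antisym (p∩q⊆p p q) (λ x∈p → x∈p∩q⁺ (x∈p , p⊆q x∈p))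

realizes⇔T⊆∧⊆⊤─[S─T] : {E T S : Subset n} → T ⊆ S → Realizes E T S ⇔ (T ⊆ E × E ⊆ ⊤ ─ (S ─ T))
realizes⇔T⊆∧⊆⊤─[S─T] {E = E} {T} {S} T⊆S = mk⇔ realizes⇒between between⇒realizes
  where
  realizes⇒between : E ∩ S ≡ T → T ⊆ E × E ⊆ ⊤ ─ (S ─ T)
  realizes⇒between E∩S≡T = T⊆E , E⊆V'
    where
    T⊆E : T ⊆ E
    T⊆E x∈T = proj₁ (x∈p∩q⁻ E S (subst (_ ∈_) (sym E∩S≡T) x∈T))

    E⊆V' : E ⊆ ⊤ ─ (S ─ T)
    E⊆V' {x} x∈E = x∈p∧x∉q⇒x∈p─q ∈⊤ λ x∈S─T →
      x∈p─q⇒x∉q S T x∈S─T (subst (x ∈_) E∩S≡T (x∈p∩q⁺ (x∈E , p─q⊆p S T x∈S─T)))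

  E∩S⊆T : E ⊆ ⊤ ─ (S ─ T) → E ∩ S ⊆ T
  E∩S⊆T E⊆V' {x} x∈E∩S with x ∈? T | x∈p∩q⁻ E S x∈E∩S
  ... | yes x∈T | _         = x∈T
  ... | no  x∉T | x∈E , x∈S = contradiction (x∈p∧x∉q⇒x∈p─q x∈S x∉T) (x∈p─q⇒x∉q ⊤ (S ─ T) (E⊆V' x∈E))

  between⇒realizes : T ⊆ E × E ⊆ ⊤ ─ (S ─ T) → E ∩ S ≡ T
  between⇒realizes (T⊆E , E⊆V') = ⊆-antisym (E∩S⊆T E⊆V') (λ x∈T → x∈p∩q⁺ (T⊆E x∈T , T⊆S x∈T))

∩-restrict : {X W : Subset n} (F : Subset n) → X ⊆ W → X ∩ (F ∩ W) ≡ X ∩ F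
∩-restrict {X = X} {W} F X⊆W = begin
  X ∩ (F ∩ W)  ≡⟨ cong (X ∩_) (∩-comm F W) ⟩
  X ∩ (W ∩ F)  ≡⟨ ∩-assoc X W F ⟨
  (X ∩ W) ∩ F  ≡⟨ cong (_∩ F) (p⊆q⇒p∩q≡p X⊆W) ⟩
  X ∩ F        ∎
  where open ≡-Reasoning

meets-restrict⇔meets : {X W : Subset n} (H : Hypergraph n) → X ⊆ W →
  (∀ {E} → E ∈ₗ restrict W H → Nonempty (X ∩ E)) ⇔ (∀ {F} → F ∈ₗ H → Nonempty (X ∩ F))
meets-restrict⇔meets {X = X} {W} H X⊆W = mk⇔
  (λ meets {F} F∈H → subst Nonempty (∩-restrict F X⊆W) (meets (∈-map⁺ (_∩ W) F∈H)))
  meets-restrict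
  where
  meets-restrict : (∀ {F} → F ∈ₗ H → Nonempty (X ∩ F)) → ∀ {E} → E ∈ₗ restrict W H → Nonempty (X ∩ E)
  meets-restrict meets E∈ with ∈-map⁻ (_∩ W) E∈
  ... | F , F∈H , refl = subst Nonempty (sym (∩-restrict F X⊆W)) (meets F∈H)

transversal⇔transversalOn-restrict : {Y W : Subset n} (H : Hypergraph n) → Y ⊆ W →
  TransversalOn ⊤ H Y ⇔ TransversalOn W (restrict W H) Y
transversal⇔transversalOn-restrict H Y⊆W = mk⇔
  (λ (_ , meets) → Y⊆W , from (meets-restrict⇔meets H Y⊆W) meets)
  (λ (_ , meets) → ⊆⊤ , to (meets-restrict⇔meets H Y⊆W) meets)

minimalTransversal⇔minimalTransversalOn-restrict : {X W : Subset n} (H : Hypergraph n) →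
  (MinimalTransversal H X × X ⊆ W) ⇔ MinimalTransversalOn W (restrict W H) X
minimalTransversal⇔minimalTransversalOn-restrict H = mk⇔
  (λ ((tX , minX) , X⊆W) →
    to (transversal⇔transversalOn-restrict H X⊆W) tX ,
    λ Y Y⊆X tY → minX Y Y⊆X (from (transversal⇔transversalOn-restrict H (⊆-trans Y⊆X X⊆W)) tY))
  (λ (tX , minX) → let X⊆W = proj₁ tX in
    (from (transversal⇔transversalOn-restrict H X⊆W) tX ,
     λ Y Y⊆X tY → minX Y Y⊆X (to (transversal⇔transversalOn-restrict H (⊆-trans Y⊆X X⊆W)) tY)) ,
    X⊆W)

lemma3 : ∀ {n} (G : Hypergraph n) (k : ℕ) (T S : Subset n) → IsTrace k T S →
    (Σ (Subset n) (λ E → MinimalTransversal G E × Realizes E T S))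
      ⇔ SubTransversalOn (⊤ ─ (S ─ T)) (restrict (⊤ ─ (S ─ T)) G) T
lemma3 G k T S (T⊆S , _) = mk⇔
  (λ (E , minE , realizes) →
    let T⊆E , E⊆V' = to (realizes⇔T⊆∧⊆⊤─[S─T] T⊆S) realizes
    in E , to (minimalTransversal⇔minimalTransversalOn-restrict G) (minE , E⊆V') , T⊆E)
  (λ (X , minX' , T⊆X) →
    let minX , X⊆V' = from (minimalTransversal⇔minimalTransversalOn-restrict G) minX'
    in X , minX , from (realizes⇔T⊆∧⊆⊤─[S─T] T⊆S) (T⊆X , X⊆V'))
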